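{- Let $G=(V,E)$ be a connected graph and let $v\in V$ with $\deg(v)=2$. Then $v$ is either a boundary vertex of $G$ (i.e. $v\in\partial G$) or a cut vertex of $G$.
   Context: Graphs are finite, simple, undirected; $d$ is the shortest-path distance. For a connected graph $G=(V,E)$, the Steinerberger boundary is $\partial G=\{v\in V:\ \exists u\in V \text{ with } \frac{1}{\deg(v)}\sum_{w\in N(v)} d(w,u)<d(v,u)\}$ (with $\partial G=V$ if $|V|=1$). A cut vertex is a vertex whose deletion (with incident edges) disconnects the graph. -}

module Defs where

open import Data.Nat using (ℕ; zero; suc; _+_; _*_; _<_; _≤_)
open import Data.Fin using (Fin)
open import Data.Bool using (Bool; true; false; T)
open import Data.List using (List; filter; length; map)
open import Data.Nat.ListAction using (sum)
open import Data.List using () renaming (allFin to allFinL)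
open import Data.Product using (Σ; _×_; ∃; ∃-syntax)
open import Data.Sum using (_⊎_)
open import Relation.Binary.PropositionalEquality using (_≡_; _≢_)
open import Relation.Nullary.Decidable using (T?)
open import Relation.Nullary using (¬_)

record Graph (n : ℕ) : Set where
  field
    adj   : Fin n → Fin n → Bool
    sym   : ∀ u v → adj u v ≡ adj v u
    irrefl : ∀ v → adj v v ≡ false
open Graph public

module _ {n : ℕ} (G : Graph n) where

  Adj : Fin n → Fin n → Set
  Adj u v = T (adj G u v)

  data Walk : Fin n → Fin n → ℕ → Set where
    here : ∀ {a} → Walk a a 0
    step : ∀ {a b c k} → Adj a b → Walk b c k → Walk a c (suc k)

  data WalkAvoiding (x : Fin n) : Fin n → Fin n → Set where
    here : ∀ {a} → a ≢ x → WalkAvoiding x a a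
    step : ∀ {a b c} → a ≢ x → Adj a b → WalkAvoiding x b c → WalkAvoiding x a c

  Connected : Set
  Connected = ∀ a b → ∃[ k ] Walk a b k

  IsShortestPathDist : (Fin n → Fin n → ℕ) → Set
  IsShortestPathDist d = ∀ a b → Walk a b (d a b) × (∀ k → Walk a b k → d a b ≤ k)

  neighbours : Fin n → List (Fin n)
  neighbours v = filter (λ w → T? (adj G v w)) (allFinL n)

  deg : Fin n → ℕ
  deg v = length (neighbours v)

  -- Steinerberger boundary, with (1/deg v) Σ_{w∈N(v)} d(w,u) < d(v,u)
  -- multiplied out by deg v; and ∂G = V when |V| = 1.
  InBoundary : (Fin n → Fin n → ℕ) → Fin n → Set
  InBoundary d v = (n ≡ 1) ⊎
    ∃[ u ] sum (map (λ w → d w u) (neighbours v)) < deg v * d v u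

  IsCutVertex : Fin n → Set
  IsCutVertex v = ∃[ a ] ∃[ b ] (a ≢ v × b ≢ v × ¬ WalkAvoiding v a b)

{-# OPTIONS --safe #-}
module Submission where

-- Suppose v ∉ ∂G and let a, b be its two neighbours; then 2 d(v,u) ≤ d(a,u) + d(b,u)
-- for every u. A shortest path from v to any u ≠ v leaves v through a or through b, so
-- d(v,u) exceeds d(a,u) or d(b,u) by one, which forces |d(a,u) − d(b,u)| ≥ 2. Since
-- d(a,·) and d(b,·) change by at most one along an edge, the sign of d(a,·) − d(b,·)
-- cannot change along an edge of G − v; it is negative at a and positive at b, so no
-- path of G − v joins a to b.

open import Defs
open import Data.Nat using (ℕ; suc; _+_; _*_; _≤_; s≤s; _<?_)
open import Data.Nat.Properties
  using (≤-trans; ≤-reflexive; +-mono-≤; +-cancelˡ-≤; +-comm; +-suc; +-identityʳ; n≤1+n; 1+n≰n; n≮0; n≤0⇒n≡0; ≮⇒≥)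
open import Data.Nat.ListAction using (sum)
open import Data.Fin using (Fin)
open import Data.Fin.Properties using (any?)
open import Data.Bool using (T)
open import Data.List using (List; []; _∷_; length; map; allFin)
open import Data.List.Membership.Propositional using (_∈_)
open import Data.List.Membership.Propositional.Properties using (∈-filter⁻; ∈-filter⁺; ∈-allFin)
open import Data.List.Relation.Unary.Any using (here; there)
open import Data.Product using (_×_; _,_; proj₁; proj₂; ∃-syntax; ∃₂)
open import Data.Sum using (_⊎_; inj₁; inj₂)
open import Data.Empty using (⊥-elim)
open import Relation.Nullary using (¬_; yes; no)
open import Relation.Nullary.Decidable using (T?)
open import Relation.Binary.PropositionalEquality
  using (_≡_; _≢_; refl; trans; cong; subst; subst₂) renaming (sym to ≡-sym)

length≡2⇒pair : ∀ {A : Set} (xs : List A) → length xs ≡ 2 → ∃₂ λ a b → xs ≡ a ∷ b ∷ []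
length≡2⇒pair (a ∷ b ∷ []) refl = a , b , refl

double-gap : ∀ {m k p} → suc m ≤ k → k + k ≤ m + p → 2 + m ≤ p
double-gap {m} m<k k+k≤m+p = +-cancelˡ-≤ m _ _
  (≤-trans (≤-reflexive (+-suc m (suc m))) (≤-trans (+-mono-≤ m<k m<k) k+k≤m+p))

module _ {n : ℕ} (G : Graph n) where

  Adj-sym : ∀ {x y} → Adj G x y → Adj G y x
  Adj-sym {x} {y} = subst T (Graph.sym G x y)

  Adj⇒≢ : ∀ {x y} → Adj G x y → x ≢ y
  Adj⇒≢ {x} e refl = subst T (irrefl G x) e

  Walk-snoc : ∀ {x y z k} → Walk G x y k → Adj G y z → Walk G x z (suc k)
  Walk-snoc here e′ = step e′ here
  Walk-snoc (step e w) e′ = step e (Walk-snoc w e′)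

  WalkAvoiding-head≢ : ∀ {v x y} → WalkAvoiding G v x y → x ≢ v
  WalkAvoiding-head≢ (here x≢v) = x≢v
  WalkAvoiding-head≢ (step x≢v _ _) = x≢v

  ∈neighbours⇒Adj : ∀ {v w} → w ∈ neighbours G v → Adj G v w
  ∈neighbours⇒Adj {v} w∈ = proj₂ (∈-filter⁻ (λ w → T? (adj G v w)) {xs = allFin n} w∈)

  Adj⇒∈neighbours : ∀ {v w} → Adj G v w → w ∈ neighbours G v
  Adj⇒∈neighbours {v} {w} = ∈-filter⁺ (λ w → T? (adj G v w)) (∈-allFin w)

  OneLipschitz : (Fin n → ℕ) → Set
  OneLipschitz f = ∀ {x y} → Adj G x y → f y ≤ suc (f x)

  Separated : (Fin n → ℕ) → (Fin n → ℕ) → Fin n → Set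
  Separated f g x = 2 + f x ≤ g x ⊎ 2 + g x ≤ f x

  module _ {f g : Fin n → ℕ} (f-lip : OneLipschitz f) (g-lip : OneLipschitz g) where

    separated-step : ∀ {x y} → Adj G x y → 2 + f x ≤ g x → Separated f g y → 2 + f y ≤ g y
    separated-step e fx<gx (inj₁ fy<gy) = fy<gy
    separated-step e fx<gx (inj₂ gy<fy) =
      ⊥-elim (1+n≰n (≤-trans (n≤1+n _)
        (≤-trans (s≤s (≤-trans gy<fy (f-lip e))) (≤-trans fx<gx (g-lip (Adj-sym e))))))

    separated-along-walk : ∀ {v x y} → (∀ z → z ≢ v → Separated f g z) →
      WalkAvoiding G v x y → 2 + f x ≤ g x → 2 + f y ≤ g y
    separated-along-walk sep (here _) fx<gx = fx<gx
    separated-along-walk sep (step _ e w) fx<gx =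
      separated-along-walk sep w (separated-step e fx<gx (sep _ (WalkAvoiding-head≢ w)))

    separated-zeros-not-joined : ∀ {v a b} → (∀ z → z ≢ v → Separated f g z) →
      f a ≡ 0 → g b ≡ 0 → ¬ WalkAvoiding G v a b
    separated-zeros-not-joined {a = a} {b} sep fa≡0 gb≡0 w with sep a (WalkAvoiding-head≢ w)
    ... | inj₂ ga<fa = n≮0 (≤-trans ga<fa (≤-reflexive fa≡0))
    ... | inj₁ fa<ga = n≮0 (≤-trans (separated-along-walk sep w fa<ga) (≤-reflexive gb≡0))

  module _ {d : Fin n → Fin n → ℕ} (isDist : IsShortestPathDist G d) where

    dist≤length : ∀ {x y} k → Walk G x y k → d x y ≤ k
    dist≤length k = proj₂ (isDist _ _) k

    dist-self : ∀ x → d x x ≡ 0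
    dist-self x = n≤0⇒n≡0 (dist≤length 0 here)

    dist-oneLipschitz : ∀ x → OneLipschitz (d x)
    dist-oneLipschitz x e = dist≤length _ (Walk-snoc (proj₁ (isDist _ _)) e)

    dist-first-step : ∀ {x y} → x ≢ y → ∃[ w ] Adj G x w × suc (d w y) ≤ d x y
    dist-first-step {x} {y} x≢y with d x y | proj₁ (isDist x y)
    ... | _ | here = ⊥-elim (x≢y refl)
    ... | _ | step e w = _ , e , s≤s (dist≤length _ w)

    module _ {v a b : Fin n} (nbr : ∀ w → Adj G v w → w ≡ a ⊎ w ≡ b)
             (midpoint : ∀ u → d v u + d v u ≤ d a u + d b u) where

      separated-off : ∀ y → y ≢ v → Separated (d a) (d b) y
      separated-off y y≢v with dist-first-step (λ v≡y → y≢v (≡-sym v≡y))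
      ... | w , e , w<v with nbr w e
      ... | inj₁ refl = inj₁ (double-gap w<v (midpoint y))
      ... | inj₂ refl = inj₂ (double-gap w<v (≤-trans (midpoint y) (≤-reflexive (+-comm (d a y) _))))

      midpoint⇒separates : ¬ WalkAvoiding G v a b
      midpoint⇒separates = separated-zeros-not-joined (dist-oneLipschitz a) (dist-oneLipschitz b)
        separated-off (dist-self a) (dist-self b)

corollary3p4 : (n : ℕ) (G : Graph n) → Connected G →
    (d : Fin n → Fin n → ℕ) → IsShortestPathDist G d →
    (v : Fin n) → deg G v ≡ 2 →
    InBoundary G d v ⊎ IsCutVertex G v
corollary3p4 n G _ d isDist v deg≡2 with length≡2⇒pair (neighbours G v) deg≡2
... | a , b , N≡ab
  with any? (λ u → sum (map (λ w → d w u) (neighbours G v)) <? deg G v * d v u)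
... | yes ∃u = inj₁ (inj₂ ∃u)
... | no ∄u = inj₂ (a , b , ≢v (here refl) , ≢v (there (here refl)) ,
                    midpoint⇒separates G isDist neighbour-a∨b midpoint)
  where
    ≢v : ∀ {w} → w ∈ a ∷ b ∷ [] → w ≢ v
    ≢v w∈ w≡v = Adj⇒≢ G (∈neighbours⇒Adj G (subst (_ ∈_) (≡-sym N≡ab) w∈)) (≡-sym w≡v)

    neighbour-a∨b : ∀ w → Adj G v w → w ≡ a ⊎ w ≡ b
    neighbour-a∨b w e with subst (w ∈_) N≡ab (Adj⇒∈neighbours G e)
    ... | here w≡a = inj₁ w≡a
    ... | there (here w≡b) = inj₂ w≡b

    midpoint : ∀ u → d v u + d v u ≤ d a u + d b u
    midpoint u = subst₂ _≤_
      (trans (cong (_* d v u) deg≡2) (cong (d v u +_) (+-identityʳ (d v u))))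
      (trans (cong (λ ws → sum (map (λ w → d w u) ws)) N≡ab) (cong (d a u +_) (+-identityʳ (d b u))))
      (≮⇒≥ (λ lt → ∄u (u , lt)))
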